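{- Let Agents $=\{A\}$ be a singleton (subscripts omitted), and let $p,q$ be atomic sentences. The $\mathcal L_1(\Sigma_{\mathrm{Pub}})$ sentence $\langle \mathrm{Pub}\ p\rangle\Diamond^* q$ is not expressible in $\mathcal L_1$, even by a set of sentences: there is no set $T$ of sentences of $\mathcal L_1$ such that for every state model $\mathbf S$ and $s\in S$, $s\in[\![\langle \mathrm{Pub}\ p\rangle\Diamond^* q]\!]_{\mathbf S}$ iff $s\in[\![\psi]\!]_{\mathbf S}$ for all $\psi\in T$.
   Context: A state model is $\mathbf S=(S,\to,\|\cdot\|)$: a set, a binary relation, and a valuation $\|p\|\subseteq S$ of atomic sentences. $\mathcal L_1$ is the modal language with sentences $\mathsf{true}\mid p\mid\neg\varphi\mid\varphi\wedge\psi\mid\Box\varphi\mid\Box^*\varphi$, where $\Box$ quantifies over $\to$-successors and $\Box^*$ over the reflexive-transitive closure $\to^*$; $\Diamond^*=\neg\Box^*\neg$. $\Sigma_{\mathrm{Pub}}$ is the action signature with a single action type Pub and $\mathrm{Pub}\to\mathrm{Pub}$. The semantics of the sentence in question (public announcement of $p$ followed by reachability of $q$): $s\in[\![\langle\mathrm{Pub}\ p\rangle\Diamond^*q]\!]_{\mathbf S}$ iff $s\in\|p\|$ and there is a finite path $s=s_0\to s_1\to\dots\to s_k$ ($k\ge0$) in $\mathbf S$ with all $s_i\in\|p\|$ and $s_k\in\|q\|$ (i.e. $s$ reaches a $q$-state within the submodel of $\mathbf S$ restricted to the $p$-states). -}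

module Defs where

open import Data.Unit using (⊤)
open import Data.Empty using (⊥)
open import Data.Product using (Σ; _×_; ∃-syntax)
open import Relation.Nullary using (¬_)
open import Relation.Binary.Construct.Closure.ReflexiveTransitive using (Star)

data Form (At : Set) : Set where
  true : Form At
  atom : At → Form At
  ¬'_  : Form At → Form At
  _∧'_ : Form At → Form At → Form At
  □_   : Form At → Form At
  □*_  : Form At → Form At

record StateModel (At : Set) : Set₁ where
  field
    State : Set
    _⟶_  : State → State → Set
    ‖_‖   : At → State → Set

open StateModel public

_⊨_at_ : {At : Set} → (M : StateModel At) → Form At → State M → Set
M ⊨ true at s = ⊤
M ⊨ atom a at s = ‖ M ‖ a s
M ⊨ ¬' φ at s = ¬ (M ⊨ φ at s)
M ⊨ φ ∧' ψ at s = (M ⊨ φ at s) × (M ⊨ ψ at s)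
M ⊨ □ φ at s = ∀ t → _⟶_ M s t → M ⊨ φ at t
M ⊨ □* φ at s = ∀ t → Star (_⟶_ M) s t → M ⊨ φ at t

-- Transitions of S restricted to p-states (the submodel after announcing p).
RestrictedStep : {At : Set} → (M : StateModel At) → At → State M → State M → Set
RestrictedStep M p x y = _⟶_ M x y × ‖ M ‖ p x × ‖ M ‖ p y

-- s ∈ [[⟨Pub p⟩◇* q]]_S : s ∈ ‖p‖ and s reaches a q-state along a finite
-- path all of whose states are in ‖p‖.
PubDiaStar : {At : Set} → (M : StateModel At) → At → At → State M → Set
PubDiaStar M p q s =
  ‖ M ‖ p s × ∃[ t ] (Star (RestrictedStep M p) s t × ‖ M ‖ q t)

{-# OPTIONS --safe #-}
-- Take a model with a descending chain ⋯ → c 2 → c 1 → c 0, a point t with a self-loop,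
-- and a gate u linked in both directions to every state; p holds everywhere except at u,
-- and q holds only at c 0. Every state reaches every other, so □* acts as the global
-- modality, and c (k + 1) and t agree on all sentences of □-depth at most k: each sees the
-- gate and a p-successor that is not a q-state, and the two successors again agree one
-- level down. Within the p-states, c k reaches c 0 but t reaches only itself. Were T a
-- definition, every ψ ∈ T would hold at c (□-depth ψ + 1), hence at t, so t would satisfy
-- ⟨Pub p⟩◇*q.
module Submission where

open import Defs
open import Data.Product using (Σ; _×_; _,_; proj₁; proj₂)
open import Data.Product.Function.NonDependent.Propositional using (_×-⇔_)
open import Data.Sum using (_⊎_; inj₁; inj₂)
open import Data.Unit using (⊤; tt)
open import Data.Empty using (⊥)
open import Data.Nat using (ℕ; zero; suc; _⊔_; _≤_; s≤s)
open import Data.Nat.Properties using (≤-refl; m⊔n≤o⇒m≤o; m⊔n≤o⇒n≤o)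
open import Function.Bundles using (_⇔_; mk⇔; Equivalence)
open import Function.Construct.Identity using (⇔-id)
open import Function.Related.TypeIsomorphisms using (¬-cong-⇔)
open import Relation.Nullary using (¬_)
open import Relation.Binary.PropositionalEquality using (_≡_; _≢_; refl; sym)
open import Relation.Binary.Construct.Closure.ReflexiveTransitive using (Star; ε; _◅_; _◅◅_)

□-depth : {At : Set} → Form At → ℕ
□-depth true      = 0
□-depth (atom _)  = 0
□-depth (¬' φ)    = □-depth φ
□-depth (φ ∧' ψ)  = □-depth φ ⊔ □-depth ψ
□-depth (□ φ)     = suc (□-depth φ)
□-depth (□* φ)    = □-depth φ

StronglyConnected : {At : Set} → StateModel At → Set
StronglyConnected M = ∀ x y → Star (_⟶_ M) x y

□*-global : {At : Set} (M : StateModel At) → StronglyConnected M →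
            (φ : Form At) (x y : State M) → M ⊨ □* φ at x ⇔ M ⊨ □* φ at y
□*-global M conn φ x y = mk⇔ (λ h z _ → h z (conn x z)) (λ h z _ → h z (conn y z))

data St : Set where
  c : ℕ → St
  u : St
  t : St

data Step : St → St → Set where
  c-down   : ∀ {k} → Step (c (suc k)) (c k)
  c-to-u   : ∀ {k} → Step (c k) u
  u-to-c   : ∀ {k} → Step u (c k)
  u-to-t   : Step u t
  t-loop   : Step t t
  t-to-u   : Step t u

IsP : St → Set
IsP u = ⊥
IsP _ = ⊤

IsQ : St → Set
IsQ (c zero) = ⊤
IsQ _        = ⊥

Step-stronglyConnected : ∀ x y → Star Step x y
Step-stronglyConnected x y = to-u x ◅◅ from-u y
  where
  to-u : ∀ x → Star Step x u
  to-u (c _) = c-to-u ◅ ε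
  to-u u     = ε
  to-u t     = t-to-u ◅ ε
  from-u : ∀ y → Star Step u y
  from-u (c _) = u-to-c ◅ ε
  from-u u     = ε
  from-u t     = u-to-t ◅ ε

module Counterexample {At : Set} (p q : At) where

  valuation : At → St → Set
  valuation a x = (a ≡ p × IsP x) ⊎ (a ≡ q × IsQ x)

  M : StateModel At
  M = record { State = St ; _⟶_ = Step ; ‖_‖ = valuation }

  p-at-c : ∀ k → valuation p (c k)
  p-at-c _ = inj₁ (refl , tt)

  c-suc⇔t : (φ : Form At) (k : ℕ) → □-depth φ ≤ k → M ⊨ φ at c (suc k) ⇔ M ⊨ φ at t
  c-suc⇔t true      k _ = ⇔-id _
  c-suc⇔t (atom a)  k _ = ⇔-id _  -- both sides reduce to (a ≡ p × ⊤) ⊎ (a ≡ q × ⊥)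
  c-suc⇔t (¬' φ)    k d = ¬-cong-⇔ (c-suc⇔t φ k d)
  c-suc⇔t (φ ∧' ψ)  k d =
    c-suc⇔t φ k (m⊔n≤o⇒m≤o (□-depth φ) _ d) ×-⇔ c-suc⇔t ψ k (m⊔n≤o⇒n≤o _ (□-depth ψ) d)
  c-suc⇔t (□ φ) (suc k) (s≤s d) = mk⇔ to from
    where
    open Equivalence (c-suc⇔t φ k d) renaming (to to down; from to up)
    to : M ⊨ □ φ at c (suc (suc k)) → M ⊨ □ φ at t
    to h .t t-loop = down (h (c (suc k)) c-down)
    to h .u t-to-u = h u c-to-u
    from : M ⊨ □ φ at t → M ⊨ □ φ at c (suc (suc k))
    from h .(c (suc k)) c-down = up (h t t-loop)
    from h .u c-to-u = h u t-to-u
  c-suc⇔t (□* φ)    k _ = □*-global M Step-stronglyConnected φ (c (suc k)) t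

  c-pubDiaStar : ∀ k → PubDiaStar M p q (c k)
  c-pubDiaStar k = p-at-c k , c zero , descend k , inj₂ (refl , tt)
    where
    descend : ∀ k → Star (RestrictedStep M p) (c k) (c zero)
    descend zero    = ε
    descend (suc k) = (c-down , p-at-c (suc k) , p-at-c k) ◅ descend k

  t-restricted-stays : ∀ {y} → Star (RestrictedStep M p) t y → y ≡ t
  t-restricted-stays ε                                 = refl
  t-restricted-stays ((t-loop , _) ◅ r)                = t-restricted-stays r
  t-restricted-stays ((t-to-u , _ , inj₁ (_ , ())) ◅ _)
  t-restricted-stays ((t-to-u , _ , inj₂ (_ , ())) ◅ _)

  t-¬pubDiaStar : p ≢ q → ¬ PubDiaStar M p q t
  t-¬pubDiaStar p≢q (_ , y , r , qy) with t-restricted-stays r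
  t-¬pubDiaStar p≢q (_ , .t , _ , inj₁ (q≡p , _)) | refl = p≢q (sym q≡p)
  t-¬pubDiaStar p≢q (_ , .t , _ , inj₂ (_ , ()))  | refl

mainTheorem4 : (At : Set) (p q : At) → p ≢ q →
    ¬ Σ (Form At → Set) (λ T →
        (M : StateModel At) (s : State M) →
          (PubDiaStar M p q s → (ψ : Form At) → T ψ → M ⊨ ψ at s)
          × (((ψ : Form At) → T ψ → M ⊨ ψ at s) → PubDiaStar M p q s))
mainTheorem4 At p q p≢q (T , defines) =
  t-¬pubDiaStar p≢q (proj₂ (defines M t) T-holds-at-t)
  where
  open Counterexample p q
  T-holds-at-t : (ψ : Form At) → T ψ → M ⊨ ψ at t
  T-holds-at-t ψ Tψ =
    Equivalence.to (c-suc⇔t ψ (□-depth ψ) ≤-refl)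
      (proj₁ (defines M (c (suc (□-depth ψ)))) (c-pubDiaStar _) ψ Tψ)
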